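{- Let $A$ be a finite non-empty alphabet and $\mathbf a,\mathbf b,\mathbf c,\mathbf d\in A^+$. If $\mathbf a:\mathbf b::_{SY}\mathbf c:\mathbf d$, then $\mathbf a:\mathbf b::\mathbf c:\mathbf d$ holds in the word algebra $(A^+,\cdot,A^+)$.
   Context: $A^+$ is the set of non-empty words over $A$; $(A^+,\cdot,A^+)$ is the algebra with universe $A^+$, concatenation, and a constant symbol for every non-empty word. $\mathbf a:\mathbf b::_{SY}\mathbf c:\mathbf d$ means: there are $n\geq 0$ and letters $a_i,b_i,c_i,d_i\in A$ ($1\le i\le n$) with $\mathbf a=a_1\ldots a_n$, $\mathbf b=b_1\ldots b_n$, $\mathbf c=c_1\ldots c_n$, $\mathbf d=d_1\ldots d_n$ such that for every $i$, ($a_i=b_i$ and $c_i=d_i$) or ($a_i=c_i$ and $b_i=d_i$). Framework (full): a justification is a pair of terms $s\to t$ with every variable of $t$ occurring in $s$; $\uparrow(\mathbf a\to\mathbf b)$ is the set of justifications with $\mathbf a=s(\mathbf o)$, $\mathbf b=t(\mathbf o)$ (evaluated in the algebra) for some assignment $\mathbf o$ of elements to the variables of $s$. $\uparrow(\mathbf a\to\mathbf b:\!\cdot\,\mathbf c\to\mathbf d):=\uparrow(\mathbf a\to\mathbf b)\cap\uparrow(\mathbf c\to\mathbf d)$; a justification is trivial if it lies in all such sets. $\mathbf a\to\mathbf b:\!\cdot\,\mathbf c\to\mathbf d$ holds iff either (a) $\uparrow(\mathbf a\to\mathbf b)\cup\uparrow(\mathbf c\to\mathbf d)$ consists only of trivial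 justifications, or (b) with $J_{\mathbf e}$ denoting $\uparrow(\mathbf a\to\mathbf b:\!\cdot\,\mathbf c\to\mathbf e)$ minus trivial justifications, $J_{\mathbf d}\neq\emptyset$ and $J_{\mathbf d}\subseteq J_{\mathbf d'}$ implies $J_{\mathbf d'}\subseteq J_{\mathbf d}$ for every element $\mathbf d'$. Then $\mathbf a:\mathbf b::\mathbf c:\mathbf d$ iff $\mathbf a\to\mathbf b:\!\cdot\,\mathbf c\to\mathbf d$, $\mathbf b\to\mathbf a:\!\cdot\,\mathbf d\to\mathbf c$, $\mathbf c\to\mathbf d:\!\cdot\,\mathbf a\to\mathbf b$, $\mathbf d\to\mathbf c:\!\cdot\,\mathbf b\to\mathbf a$ all hold. -}

module Defs where

open import Data.Nat using (ℕ)
open import Data.Fin using (Fin)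
open import Data.List using (List; []; _∷_)
open import Data.List.NonEmpty using (List⁺; toList; _⁺++⁺_)
open import Data.Product using (Σ; ∃; _×_; _,_)
open import Data.Sum using (_⊎_)
open import Relation.Nullary using (¬_)
open import Relation.Binary.PropositionalEquality using (_≡_)

-- Alphabet: a finite non-empty set, represented as Fin (suc k).
-- Words: non-empty lists (A⁺), with concatenation _⁺++⁺_.

module WordAlgebra (A : Set) where

  Word : Set
  Word = List⁺ A

  data Term : Set where
    var   : ℕ → Term
    const : Word → Term
    _·_   : Term → Term → Term

  data Occurs (x : ℕ) : Term → Set where
    here  : Occurs x (var x)
    left  : ∀ {s t} → Occurs x s → Occurs x (s · t)
    right : ∀ {s t} → Occurs x t → Occurs x (s · t)

  eval : (ℕ → Word) → Term → Word
  eval o (var x)   = o x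
  eval o (const w) = w
  eval o (s · t)   = eval o s ⁺++⁺ eval o t

  record Justification : Set where
    constructor _⇒_∣_
    field
      lhs  : Term
      rhs  : Term
      vars : ∀ x → Occurs x rhs → Occurs x lhs
  open Justification public

  Up : Word → Word → Justification → Set
  Up a b j = ∃ λ (o : ℕ → Word) → (eval o (lhs j) ≡ a) × (eval o (rhs j) ≡ b)

  Up₂ : Word → Word → Word → Word → Justification → Set
  Up₂ a b c d j = Up a b j × Up c d j

  Trivial : Justification → Set
  Trivial j = ∀ a b c d → Up₂ a b c d j

  J : Word → Word → Word → Word → Justification → Set
  J a b c e j = Up₂ a b c e j × ¬ Trivial j

  Arrow : Word → Word → Word → Word → Set
  Arrow a b c d =
    (∀ j → Up a b j ⊎ Up c d j → Trivial j)
    ⊎ ( (∃ λ j → J a b c d j)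
      × (∀ d' → (∀ j → J a b c d j → J a b c d' j)
              → (∀ j → J a b c d' j → J a b c d j)))

  Analogy : Word → Word → Word → Word → Set
  Analogy a b c d =
    Arrow a b c d × Arrow b a d c × Arrow c d a b × Arrow d c b a

  data SYList : List A → List A → List A → List A → Set where
    []  : SYList [] [] [] []
    _∷_ : ∀ {a b c d as bs cs ds}
        → ((a ≡ b × c ≡ d) ⊎ (a ≡ c × b ≡ d))
        → SYList as bs cs ds
        → SYList (a ∷ as) (b ∷ bs) (c ∷ cs) (d ∷ ds)

  SY : Word → Word → Word → Word → Set
  SY a b c d = SYList (toList a) (toList b) (toList c) (toList d)

-- A syntactic analogy is one letter-wise rewrite pattern applied to both pairs:
-- at each position the letter is either copied (a = b, c = d) or one fixed
-- letter is replaced by another (a = c, b = d). Reading copies as variables and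
-- replacements as constants turns the pattern into a justification lying in
-- ↑(a → b) and ↑(c → d). Every term of the pattern evaluates to a non-empty
-- word and c has exactly as many letters as the pattern has positions, so
-- matching c forces each variable to be a single letter: the justification
-- determines d from c. A justification with determined right-hand side is
-- non-trivial and belongs to J_d' only for d' = d, which gives the maximality
-- of J_d; the other three arrows come from the same pattern, with the
-- replacements reversed where the pairs are swapped.
module Submission where

open import Defs
open import Data.Nat using (ℕ; suc; zero; _≤_; s≤s; z≤n)
open import Data.Nat.Properties using (≤-trans; 1+n≢n; <-irrefl)
open import Data.Fin using (Fin)
open import Data.List using (List; []; _∷_; map)
import Data.List as List
open import Data.List.Properties using (length-++-≤ʳ)
open import Data.List.NonEmpty using (_∷_; [_]; _∷⁺_; toList; head; tail; length; _⁺++⁺_)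
open import Data.Product using (∃; _×_; _,_; proj₁; proj₂)
open import Data.Sum using (inj₁; inj₂)
open import Data.Unit using (⊤; tt)
open import Data.Empty using (⊥-elim)
open import Function using (_∘_)
open import Relation.Nullary using (¬_)
open import Relation.Binary.PropositionalEquality using (_≡_; refl; sym; trans; cong; cong₂; subst)

module WordAnalogy (A : Set) where
  open WordAlgebra A

  ⁺++⁺-split : (w r : Word) {y : A} {ys : Word} →
               length ys ≤ length r → w ⁺++⁺ r ≡ y ∷⁺ ys → w ≡ [ y ] × r ≡ ys
  ⁺++⁺-split (w ∷ []) r _ refl = refl , refl
  ⁺++⁺-split (w ∷ v ∷ ws) r ys≤r refl =
    ⊥-elim (<-irrefl refl (≤-trans (s≤s (length-++-≤ʳ (toList r) {ws})) ys≤r))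

  Determines : Word → Word → Justification → Set
  Determines c d j = ∀ e → Up c e j → e ≡ d

  determines⇒nontrivial : ∀ {c d j} → Determines c d j → ¬ Trivial j
  determines⇒nontrivial {c} {d} det trivial =
    1+n≢n (cong length (det (head d ∷⁺ d) (proj₁ (trivial c (head d ∷⁺ d) c d))))

  determines⇒arrow : ∀ {a b c d} j → Up a b j → Up c d j → Determines c d j → Arrow a b c d
  determines⇒arrow {a} {b} {c} {d} j ab cd det = inj₂ ((j , (ab , cd) , nontrivial) , maximal)
    where
    nontrivial : ¬ Trivial j
    nontrivial = determines⇒nontrivial {j = j} det

    maximal : ∀ d' → (∀ j' → J a b c d j' → J a b c d' j') →
              ∀ j' → J a b c d' j' → J a b c d j'
    maximal d' J≤J' j' j'∈J' =
      subst (λ e → J a b c e j') (det d' (proj₂ (proj₁ (J≤J' j ((ab , cd) , nontrivial))))) j'∈J'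

  data Pattern : Set where
    copy    : Pattern
    replace : A → A → Pattern

  invert : Pattern → Pattern
  invert copy          = copy
  invert (replace x y) = replace y x

  infix 4 _⊢_↝_ _⊢*_↝_

  data _⊢_↝_ : Pattern → A → A → Set where
    copy    : ∀ {x} → copy ⊢ x ↝ x
    replace : ∀ {x y} → replace x y ⊢ x ↝ y

  data _⊢*_↝_ : List Pattern → List A → List A → Set where
    []  : [] ⊢* [] ↝ []
    _∷_ : ∀ {p ps x xs y ys} →
          p ⊢ x ↝ y → ps ⊢* xs ↝ ys → p ∷ ps ⊢* x ∷ xs ↝ y ∷ ys

  ⊢-invert : ∀ {p x y} → p ⊢ x ↝ y → invert p ⊢ y ↝ x
  ⊢-invert copy    = copy
  ⊢-invert replace = replace

  ⊢*-invert : ∀ {ps xs ys} → ps ⊢* xs ↝ ys → map invert ps ⊢* ys ↝ xs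
  ⊢*-invert []       = []
  ⊢*-invert (r ∷ rs) = ⊢-invert r ∷ ⊢*-invert rs

  sy⇒pattern : ∀ {as bs cs ds} → SYList as bs cs ds →
               ∃ λ ps → ps ⊢* as ↝ bs × ps ⊢* cs ↝ ds
  sy⇒pattern [] = [] , [] , []
  sy⇒pattern (inj₁ (refl , refl) ∷ sy) with sy⇒pattern sy
  ... | ps , ab , cd = copy ∷ ps , copy ∷ ab , copy ∷ cd
  sy⇒pattern (inj₂ (refl , refl) ∷ sy) with sy⇒pattern sy
  ... | ps , ab , cd = replace _ _ ∷ ps , replace ∷ ab , replace ∷ cd

  lhsTerm rhsTerm : ℕ → Pattern → Term
  lhsTerm i copy          = var i
  lhsTerm i (replace x y) = const [ x ]
  rhsTerm i copy          = var i
  rhsTerm i (replace x y) = const [ y ]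

  chain : (ℕ → Pattern → Term) → ℕ → Pattern → List Pattern → Term
  chain t i p []       = t i p
  chain t i p (q ∷ ps) = t i p · chain t (suc i) q ps

  chain-rhs-vars : ∀ i p ps x → Occurs x (chain rhsTerm i p ps) → Occurs x (chain lhsTerm i p ps)
  chain-rhs-vars i copy          [] x x∈rhs = x∈rhs
  chain-rhs-vars i (replace _ _) [] x ()
  chain-rhs-vars i p (q ∷ ps) x (left x∈rhs)  = left (chain-rhs-vars i p [] x x∈rhs)
  chain-rhs-vars i p (q ∷ ps) x (right x∈rhs) = right (chain-rhs-vars (suc i) q ps x x∈rhs)

  patternJustification : Pattern → List Pattern → Justification
  patternJustification p ps = chain lhsTerm 0 p ps ⇒ chain rhsTerm 0 p ps ∣ chain-rhs-vars 0 p ps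

  Spells : (ℕ → Word) → ℕ → List A → Set
  Spells o i []       = ⊤
  Spells o i (x ∷ xs) = o i ≡ [ x ] × Spells o (suc i) xs

  Spells-suc : ∀ o i xs → Spells (o ∘ suc) i xs → Spells o (suc i) xs
  Spells-suc o i []       _         = tt
  Spells-suc o i (x ∷ xs) (oi , sp) = oi , Spells-suc o (suc i) xs sp

  spelling : A → List A → ℕ → Word
  spelling x xs       zero    = [ x ]
  spelling x []       (suc n) = [ x ]
  spelling x (y ∷ ys) (suc n) = spelling y ys n

  spelling-spells : ∀ x xs → Spells (spelling x xs) 0 (x ∷ xs)
  spelling-spells x []       = refl , tt
  spelling-spells x (y ∷ ys) = refl , Spells-suc (spelling x (y ∷ ys)) 0 (y ∷ ys) (spelling-spells y ys)

  lhsTerm-spelled : ∀ {o i p x y} → p ⊢ x ↝ y → o i ≡ [ x ] → eval o (lhsTerm i p) ≡ [ x ]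
  lhsTerm-spelled copy    oi = oi
  lhsTerm-spelled replace _  = refl

  rhsTerm-determined : ∀ {o i p x y} → p ⊢ x ↝ y →
                       eval o (lhsTerm i p) ≡ [ x ] → eval o (rhsTerm i p) ≡ [ y ]
  rhsTerm-determined copy    lhs≡x = lhs≡x
  rhsTerm-determined replace _     = refl

  lhs-spelled : ∀ {o i p ps x xs ys} → p ∷ ps ⊢* x ∷ xs ↝ ys → Spells o i (x ∷ xs) →
                eval o (chain lhsTerm i p ps) ≡ x ∷ xs
  lhs-spelled (r ∷ [])         (oi , _)  = lhsTerm-spelled r oi
  lhs-spelled (r ∷ rs@(_ ∷ _)) (oi , sp) = cong₂ _⁺++⁺_ (lhsTerm-spelled r oi) (lhs-spelled rs sp)

  chain-length : ∀ {t p ps xs ys} o i → p ∷ ps ⊢* xs ↝ ys →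
                 List.length xs ≤ length (eval o (chain t i p ps))
  chain-length o i (_ ∷ [])                  = s≤s z≤n
  chain-length {t} {p} o i (_ ∷ rs@(_ ∷ _)) =
    s≤s (≤-trans (chain-length o (suc i) rs) (length-++-≤ʳ _ {tail (eval o (t i p))}))

  rhs-determined : ∀ {o i p ps x xs y ys} → p ∷ ps ⊢* x ∷ xs ↝ y ∷ ys →
                   eval o (chain lhsTerm i p ps) ≡ x ∷ xs → eval o (chain rhsTerm i p ps) ≡ y ∷ ys
  rhs-determined (r ∷ []) lhs≡x = rhsTerm-determined r lhs≡x
  rhs-determined {o} {i} {p} {q ∷ ps} (r ∷ rs@(_ ∷ _)) lhs≡x
    with ⁺++⁺-split (eval o (lhsTerm i p)) (eval o (chain lhsTerm (suc i) q ps))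
                    (chain-length o (suc i) rs) lhs≡x
  ... | head≡x , tail≡xs =
    cong₂ _⁺++⁺_ (rhsTerm-determined r head≡x) (rhs-determined rs tail≡xs)

  pattern-up : ∀ {p ps} {a b : Word} → p ∷ ps ⊢* toList a ↝ toList b →
               Up a b (patternJustification p ps)
  pattern-up {a = x ∷ xs} r = spelling x xs , lhs≡a , rhs-determined r lhs≡a
    where lhs≡a = lhs-spelled r (spelling-spells x xs)

  pattern-determines : ∀ {p ps} {c d : Word} → p ∷ ps ⊢* toList c ↝ toList d →
                       Determines c d (patternJustification p ps)
  pattern-determines r e (o , lhs≡c , rhs≡e) = trans (sym rhs≡e) (rhs-determined r lhs≡c)

  pattern-arrow : ∀ {p ps} {a b c d : Word} →
                  p ∷ ps ⊢* toList a ↝ toList b → p ∷ ps ⊢* toList c ↝ toList d → Arrow a b c d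
  pattern-arrow {p} {ps} ab cd =
    determines⇒arrow (patternJustification p ps) (pattern-up ab) (pattern-up cd) (pattern-determines cd)

  pattern-analogy : ∀ {ps} {a b c d : Word} →
                    ps ⊢* toList a ↝ toList b → ps ⊢* toList c ↝ toList d → Analogy a b c d
  pattern-analogy ab@(_ ∷ _) cd =
    pattern-arrow ab cd , pattern-arrow (⊢*-invert ab) (⊢*-invert cd) ,
    pattern-arrow cd ab , pattern-arrow (⊢*-invert cd) (⊢*-invert ab)

  sy⇒analogy : (a b c d : Word) → SY a b c d → Analogy a b c d
  sy⇒analogy a b c d sy with sy⇒pattern sy
  ... | _ , ab , cd = pattern-analogy ab cd

mainTheorem17 : (k : ℕ) → let open WordAlgebra (Fin (suc k)) in
    (a b c d : Word) → SY a b c d → Analogy a b c d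
mainTheorem17 k = WordAnalogy.sy⇒analogy (Fin (suc k))
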